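{- Let $k \geq 3$ be an integer and let $G$ be a finite connected graph that does not contain the disjoint union $P_2 + P_k$ (a single edge together with a path on $k$ vertices) as an induced subgraph. Then $c(G) \leq k$.
   Context: Cops and Robber game on a finite connected graph $G$: a player controlling $k$ cops places them on vertices (not necessarily distinct), then the robber is placed on a vertex; then the cops and the robber alternately move, each piece in its turn either moving to an adjacent vertex or staying put. The cops win if after finitely many rounds some cop occupies the same vertex as the robber; both sides have complete information. The cop number $c(G)$ is the minimum number of cops that can guarantee capture of the robber on $G$. $P_m$ denotes the path on $m$ vertices; $G$ being $(H_1+H_2)$-free means $G$ has no induced subgraph isomorphic to the disjoint union of $H_1$ and $H_2$. -}

module Defs where

open import Data.Nat using (ℕ; zero; suc; _+_; _≤_)
open import Data.Fin using (Fin; toℕ; splitAt)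
open import Data.Sum using (_⊎_; inj₁; inj₂)
open import Data.Product using (Σ; ∃; ∃-syntax; _×_; _,_)
open import Data.Empty using (⊥)
open import Relation.Nullary using (¬_; Dec)
open import Relation.Binary.PropositionalEquality using (_≡_)
open import Function.Definitions using (Injective)
open import Function.Bundles using (_⇔_)

record Graph (n : ℕ) : Set₁ where
  field
    Adj    : Fin n → Fin n → Set
    adj?   : ∀ u v → Dec (Adj u v)
    sym    : ∀ {u v} → Adj u v → Adj v u
    irrefl : ∀ {u} → ¬ Adj u u
open Graph public

data Reach {n : ℕ} (G : Graph n) : Fin n → Fin n → Set where
  here : ∀ {u} → Reach G u u
  step : ∀ {u v w} → Adj G u v → Reach G v w → Reach G u w

Connected : ∀ {n} → Graph n → Set
Connected G = ∀ u v → Reach G u v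

PathAdj : ∀ {m} → Fin m → Fin m → Set
PathAdj i j = (toℕ j ≡ suc (toℕ i)) ⊎ (toℕ i ≡ suc (toℕ j))

UnionAdj : ∀ {a b} → (Fin a → Fin a → Set) → (Fin b → Fin b → Set)
         → Fin (a + b) → Fin (a + b) → Set
UnionAdj {a} {b} A B x y with splitAt a x | splitAt a y
... | inj₁ i | inj₁ j = A i j
... | inj₂ i | inj₂ j = B i j
... | _      | _      = ⊥

P2+PkAdj : (k : ℕ) → Fin (2 + k) → Fin (2 + k) → Set
P2+PkAdj k = UnionAdj {2} {k} PathAdj PathAdj

HasInduced : ∀ {n h} → Graph n → (Fin h → Fin h → Set) → Set
HasInduced {n} {h} G HAdj =
  Σ (Fin h → Fin n) λ f → Injective _≡_ _≡_ f × (∀ i j → HAdj i j ⇔ Adj G (f i) (f j))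

Step : ∀ {n} → Graph n → Fin n → Fin n → Set
Step G u v = (u ≡ v) ⊎ Adj G u v

Caught : ∀ {n m} → (Fin m → Fin n) → Fin n → Set
Caught cops r = ∃[ i ] (cops i ≡ r)

-- CopWin G cops r : with cops at positions 'cops', robber at r, cops to move,
-- the cops can force capture in finitely many rounds (inductive = well-founded).
data CopWin {n m : ℕ} (G : Graph n) : (Fin m → Fin n) → Fin n → Set where
  caught : ∀ {cops r} → Caught cops r → CopWin G cops r
  move   : ∀ {cops r} (cops' : Fin m → Fin n)
         → (∀ i → Step G (cops i) (cops' i))
         → (Caught cops' r ⊎ (∀ r' → Step G r r' → CopWin G cops' r'))
         → CopWin G cops r

CopsWin : ∀ {n} → Graph n → ℕ → Set
CopsWin G m = Σ (Fin m → Fin _) λ cops → ∀ r → CopWin G cops r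

CopNumber≤ : ∀ {n} → Graph n → ℕ → Set
CopNumber≤ G k = ∃[ m ] (m ≤ k × CopsWin G m)

-- Two cops guard the ends of an edge uv for the whole game, while the other k − 2 cops
-- grow an induced path P, starting at the robber's initial position, whose vertices are
-- not adjacent to u or v. Whenever the robber enters the closed neighbourhood of a
-- stationary cop he is caught, so there is always a walk from the end y of P to the
-- robber avoiding those neighbourhoods. A mobile cop walks to y; on arrival, the last
-- vertex of that walk adjacent to y extends P, the mobile cop stays on y and a cop
-- waiting at u becomes mobile. Together with uv the path is an induced P₂ + P_|P|, so P
-- never reaches k vertices and the robber is caught before the cops run out.
module Submission where

open import Defs
open import Data.Nat using (ℕ; zero; suc; _+_; _≤_; _<_; z≤n; s≤s)
open import Data.Nat.Properties using (≤-refl; <-trans; +-suc; +-comm; m≤n+m; suc-injective)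
open import Data.Fin using (Fin; zero; suc; toℕ; fromℕ<; splitAt; join; _≟_)
open import Data.Fin.Properties using (any?; toℕ-fromℕ<; join-splitAt)
open import Data.List using (List; []; _∷_; _++_; _∷ʳ_; length; reverse; lookup)
open import Data.List.Properties using (unfold-reverse; length-reverse)
open import Data.List.Relation.Unary.All as All using (All; []; _∷_)
open import Data.List.Relation.Unary.All.Properties using (++⁻ˡ; ++⁻ʳ)
open import Data.List.Relation.Unary.Any using (here; there)
open import Data.List.Relation.Unary.Any.Properties using (++⁻; reverse⁺)
open import Data.List.Membership.Propositional using (_∈_)
open import Data.List.Membership.Propositional.Properties using (∈-lookup)
open import Data.Vec.Functional using (updateAt)
open import Data.Vec.Functional.Properties using (updateAt-updates; updateAt-minimal)
open import Data.Sum as Sum using (_⊎_; inj₁; inj₂; [_,_]′)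
open import Data.Product using (∃-syntax; _×_; _,_)
open import Data.Empty using (⊥-elim)
open import Function using (const)
open import Function.Definitions using (Injective)
open import Function.Bundles using (_⇔_; mk⇔)
open import Relation.Nullary using (¬_; Dec; yes; no)
open import Relation.Binary.Definitions using (Reflexive)
open import Relation.Binary.PropositionalEquality
  using (_≡_; _≢_; _≗_; refl; trans; cong; subst) renaming (sym to ≡-sym)

m+1+n≡o⇒n<o : ∀ m {n o} → m + suc n ≡ o → n < o
m+1+n≡o⇒n<o m {n} eq = subst (n <_) eq (m≤n+m (suc n) m)

module _ {A : Set} where

  lineup : List A → A → A → ℕ → A
  lineup []       p d zero    = p
  lineup []       p d (suc _) = d
  lineup (x ∷ xs) p d zero    = x
  lineup (x ∷ xs) p d (suc j) = lineup xs p d j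

  lineup-mono : ∀ (R : A → A → Set) → Reflexive R → ∀ xs {p p′} d → R p p′
              → ∀ j → R (lineup xs p d j) (lineup xs p′ d j)
  lineup-mono R refl′ []       d pRp′ zero    = pRp′
  lineup-mono R refl′ []       d pRp′ (suc j) = refl′
  lineup-mono R refl′ (x ∷ xs) d pRp′ zero    = refl′
  lineup-mono R refl′ (x ∷ xs) d pRp′ (suc j) = lineup-mono R refl′ xs d pRp′ j

  lineup-length : ∀ xs (p d : A) → lineup xs p d (length xs) ≡ p
  lineup-length []       p d = refl
  lineup-length (x ∷ xs) p d = lineup-length xs p d

  lineup-∈ : ∀ xs (p d : A) {x} → x ∈ xs → ∃[ j ] (j < length xs × lineup xs p d j ≡ x)
  lineup-∈ (x ∷ xs) p d (here refl) = zero , s≤s z≤n , refl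
  lineup-∈ (x ∷ xs) p d (there x∈) with lineup-∈ xs p d x∈
  ... | j , j< , eq = suc j , s≤s j< , eq

  lineup-∷ʳ : ∀ xs (y d : A) → lineup (xs ∷ʳ y) d d ≗ lineup xs y d
  lineup-∷ʳ []       y d zero          = refl
  lineup-∷ʳ []       y d (suc zero)    = refl
  lineup-∷ʳ []       y d (suc (suc j)) = refl
  lineup-∷ʳ (x ∷ xs) y d zero          = refl
  lineup-∷ʳ (x ∷ xs) y d (suc j)       = lineup-∷ʳ xs y d j

module _ {n : ℕ} (G : Graph n) where

  Step-refl : Reflexive (Step G)
  Step-refl = inj₁ refl

  Step-sym : ∀ {a b} → Step G a b → Step G b a
  Step-sym (inj₁ refl) = inj₁ refl
  Step-sym (inj₂ ab)   = inj₂ (sym G ab)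

  step? : ∀ a b → Dec (Step G a b)
  step? a b with a ≟ b | adj? G a b
  ... | yes a≡b | _       = yes (inj₁ a≡b)
  ... | no _    | yes ab  = yes (inj₂ ab)
  ... | no a≢b  | no ¬ab  = no λ { (inj₁ a≡b) → a≢b a≡b ; (inj₂ ab) → ¬ab ab }

  Safe : ∀ {m} → (Fin m → Fin n) → Fin n → Set
  Safe cops r = ∀ i → ¬ Step G (cops i) r

  CopWin-capture : ∀ {m} (cops : Fin m → Fin n) {r} i → Step G (cops i) r → CopWin G cops r
  CopWin-capture cops {r} i s = move cops′ steps (inj₁ (i , updateAt-updates i cops))
    where
    cops′ : Fin _ → Fin n
    cops′ = updateAt cops i (const r)
    steps : ∀ j → Step G (cops j) (cops′ j)
    steps j with j ≟ i
    ... | yes refl = subst (Step G (cops i)) (≡-sym (updateAt-updates i cops)) s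
    ... | no j≢i   = inj₁ (≡-sym (updateAt-minimal j i cops j≢i))

  CopWin-unlessSafe : ∀ {m} {cops : Fin m → Fin n} {r} → (Safe cops r → CopWin G cops r) → CopWin G cops r
  CopWin-unlessSafe {cops = cops} {r} win with any? (λ i → step? (cops i) r)
  ... | yes (i , s) = CopWin-capture cops i s
  ... | no ¬threat  = win λ i s → ¬threat (i , s)

  CopWin-cong : ∀ {m} {cops cops′ : Fin m → Fin n} {r} → cops ≗ cops′ → CopWin G cops r → CopWin G cops′ r
  CopWin-cong eq (caught (i , ci≡r))  = caught (i , trans (≡-sym (eq i)) ci≡r)
  CopWin-cong eq (move next steps res) = move next (λ i → subst (λ c → Step G c (next i)) (eq i) (steps i)) res

  Undominated : List (Fin n) → Fin n → Set
  Undominated S x = All (λ s → ¬ Step G s x) S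

  data AvoidingWalk (S : List (Fin n)) : Fin n → Fin n → Set where
    []  : ∀ {a} → AvoidingWalk S a a
    hop : ∀ {a b c} → Step G a b → Undominated S b → AvoidingWalk S b c → AvoidingWalk S a c

  AvoidingWalk-snoc : ∀ {S a b c} → AvoidingWalk S a b → Step G b c → Undominated S c → AvoidingWalk S a c
  AvoidingWalk-snoc []                bc c-free = hop bc c-free []
  AvoidingWalk-snoc (hop ab b-free w) bc c-free = hop ab b-free (AvoidingWalk-snoc w bc c-free)

  AvoidingWalk-first : ∀ {S a b} → AvoidingWalk S a b → ¬ Undominated S a → a ≢ b
                     → ∃[ c ] (Adj G a c × Undominated S c)
  AvoidingWalk-first []                         _     a≢a = ⊥-elim (a≢a refl)
  AvoidingWalk-first (hop (inj₁ refl) b-free _) a-dom _ = ⊥-elim (a-dom b-free)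
  AvoidingWalk-first (hop (inj₂ ab) b-free _)   _     _ = _ , ab , b-free

  Exit : List (Fin n) → Fin n → Fin n → Set
  Exit S y r = ∃[ y′ ] (Adj G y y′ × Undominated S y′ × AvoidingWalk (y ∷ S) y′ r)

  module _ {S : List (Fin n)} {y r : Fin n} (y≁r : ¬ Step G y r) where

    no-walk-from : ¬ AvoidingWalk (y ∷ S) y r
    no-walk-from []                   = y≁r Step-refl
    no-walk-from (hop yb (y≁b ∷ _) _) = y≁b yb

    avoid-or-exit : ∀ {a} → AvoidingWalk S a r → AvoidingWalk (y ∷ S) a r ⊎ Exit S y r
    avoid-or-exit [] = inj₁ []
    avoid-or-exit (hop {b = b} ab b-free w) with avoid-or-exit w
    ... | inj₂ exit = inj₂ exit
    ... | inj₁ w′ with step? y b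
    ... | no y≁b          = inj₁ (hop ab (y≁b ∷ b-free) w′)
    ... | yes (inj₂ yb)   = inj₂ (b , yb , b-free , w′)
    ... | yes (inj₁ refl) = ⊥-elim (no-walk-from w′)

    last-exit : AvoidingWalk S y r → Exit S y r
    last-exit w with avoid-or-exit w
    ... | inj₁ w′   = ⊥-elim (no-walk-from w′)
    ... | inj₂ exit = exit

  IsInducedEmbedding : ∀ {h} → (Fin h → Fin h → Set) → (Fin h → Fin n) → Set
  IsInducedEmbedding H f = Injective _≡_ _≡_ f × (∀ i j → H i j ⇔ Adj G (f i) (f j))

  union-embedding : ∀ {a b} {A : Fin a → Fin a → Set} {B : Fin b → Fin b → Set} {f g}
                  → IsInducedEmbedding A f → IsInducedEmbedding B g → (∀ i j → ¬ Step G (f i) (g j))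
                  → HasInduced G (UnionAdj A B)
  union-embedding {a} {b} {A} {B} {f} {g} (f-inj , f-adj) (g-inj , g-adj) apart = h , h-inj , h-adj
    where
    h : Fin (a + b) → Fin n
    h x = [ f , g ]′ (splitAt a x)

    [f,g]-inj : ∀ s t → [ f , g ]′ s ≡ [ f , g ]′ t → s ≡ t
    [f,g]-inj (inj₁ i) (inj₁ j) e = cong inj₁ (f-inj e)
    [f,g]-inj (inj₁ i) (inj₂ j) e = ⊥-elim (apart i j (inj₁ e))
    [f,g]-inj (inj₂ i) (inj₁ j) e = ⊥-elim (apart j i (inj₁ (≡-sym e)))
    [f,g]-inj (inj₂ i) (inj₂ j) e = cong inj₂ (g-inj e)

    h-inj : Injective _≡_ _≡_ h
    h-inj {x} {y} e = trans (≡-sym (join-splitAt a b x))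
                        (trans (cong (join a b) ([f,g]-inj (splitAt a x) (splitAt a y) e)) (join-splitAt a b y))

    h-adj : ∀ x y → UnionAdj A B x y ⇔ Adj G (h x) (h y)
    h-adj x y with splitAt a x | splitAt a y
    ... | inj₁ i | inj₁ j = f-adj i j
    ... | inj₂ i | inj₂ j = g-adj i j
    ... | inj₁ i | inj₂ j = mk⇔ (λ ()) (λ ad → apart i j (inj₂ ad))
    ... | inj₂ i | inj₁ j = mk⇔ (λ ()) (λ ad → apart j i (inj₂ (sym G ad)))

  data InducedPath : List (Fin n) → Set where
    single : ∀ x → InducedPath (x ∷ [])
    extend : ∀ {x y ys} → Adj G y x → Undominated ys x → InducedPath (y ∷ ys) → InducedPath (x ∷ y ∷ ys)

  InducedPath-consecutive : ∀ {P} → InducedPath P → ∀ i j → toℕ j ≡ suc (toℕ i) → Adj G (lookup P i) (lookup P j)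
  InducedPath-consecutive (single _)         zero    zero          ()
  InducedPath-consecutive (extend _ _ _)     zero    zero          ()
  InducedPath-consecutive (extend yx _ _)    zero    (suc zero)    _ = sym G yx
  InducedPath-consecutive (extend _ _ _)     zero    (suc (suc _)) ()
  InducedPath-consecutive (extend _ _ _)     (suc _) zero          ()
  InducedPath-consecutive (extend _ _ path)  (suc i) (suc j)       e =
    InducedPath-consecutive path i j (suc-injective e)

  InducedPath-step : ∀ {P} → InducedPath P → ∀ i j → Step G (lookup P i) (lookup P j) → i ≡ j ⊎ PathAdj i j
  InducedPath-step (single _)           zero          zero          _ = inj₁ refl
  InducedPath-step (extend _ _ _)       zero          zero          _ = inj₁ refl
  InducedPath-step (extend _ _ _)       zero          (suc zero)    _ = inj₂ (inj₁ refl)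
  InducedPath-step (extend _ _ _)       (suc zero)    zero          _ = inj₂ (inj₂ refl)
  InducedPath-step (extend _ far _)     zero          (suc (suc j)) s =
    ⊥-elim (All.lookup far (∈-lookup j) (Step-sym s))
  InducedPath-step (extend _ far _)     (suc (suc i)) zero          s =
    ⊥-elim (All.lookup far (∈-lookup i) s)
  InducedPath-step (extend _ _ path)    (suc i)       (suc j)       s =
    Sum.map (cong suc) (Sum.map (cong suc) (cong suc)) (InducedPath-step path i j s)

  InducedPath-embedding : ∀ {P} → InducedPath P → IsInducedEmbedding PathAdj (lookup P)
  InducedPath-embedding {P} path = injective , λ i j → mk⇔ (adjacent i j) (reflect i j)
    where
    adjacent : ∀ i j → PathAdj i j → Adj G (lookup P i) (lookup P j)
    adjacent i j (inj₁ e) = InducedPath-consecutive path i j e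
    adjacent i j (inj₂ e) = sym G (InducedPath-consecutive path j i e)

    injective : Injective _≡_ _≡_ (lookup P)
    injective {i} {j} e with InducedPath-step path i j (inj₁ e)
    ... | inj₁ i≡j = i≡j
    ... | inj₂ ij  = ⊥-elim (irrefl G (subst (λ x → Adj G x (lookup P j)) e (adjacent i j ij)))

    reflect : ∀ i j → Adj G (lookup P i) (lookup P j) → PathAdj i j
    reflect i j ad with InducedPath-step path i j (inj₂ ad)
    ... | inj₁ refl = ⊥-elim (irrefl G ad)
    ... | inj₂ ij   = ij

  InducedPath-union : ∀ {P Q} → InducedPath P → InducedPath Q → All (Undominated P) Q
                    → HasInduced G (UnionAdj {length P} {length Q} PathAdj PathAdj)
  InducedPath-union P-path Q-path apart =
    union-embedding (InducedPath-embedding P-path) (InducedPath-embedding Q-path)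
      λ i j → All.lookup (All.lookup apart (∈-lookup j)) (∈-lookup i)

  module Strategy (connected : Connected G) (q : ℕ) {u v : Fin n} (uv : Adj G u v)
                  (no-P₂+Pk : ¬ HasInduced G (P2+PkAdj (2 + q))) where

    SeparatedPath : List (Fin n) → Set
    SeparatedPath P = InducedPath P × All (Undominated (u ∷ v ∷ [])) P

    guards : List (Fin n) → List (Fin n)
    guards ys = ys ++ u ∷ v ∷ []

    SeparatedPath-extend : ∀ {x y ys} → Adj G y x → Undominated (guards ys) x
                         → SeparatedPath (y ∷ ys) → SeparatedPath (x ∷ y ∷ ys)
    SeparatedPath-extend {ys = ys} yx x-free (path , far) =
      extend yx (++⁻ˡ ys x-free) path , ++⁻ʳ ys x-free ∷ far

    SeparatedPath-short : ∀ {P} → SeparatedPath P → length P ≢ 2 + q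
    SeparatedPath-short (path , far) len =
      no-P₂+Pk (subst (λ k → HasInduced G (P2+PkAdj k)) len
                  (InducedPath-union (extend (sym G uv) [] (single v)) path far))

    -- The path ys is stored newest vertex first, whereas cops keep their index once posted:
    -- u, v, the path in order of construction, the mobile cop at p, then cops waiting at u.
    posts : List (Fin n) → List (Fin n)
    posts ys = u ∷ v ∷ reverse ys

    cops : List (Fin n) → Fin n → Fin (2 + q) → Fin n
    cops ys p i = lineup (posts ys) p u (toℕ i)

    handover : ∀ y ys → cops (y ∷ ys) u ≗ cops ys y
    handover y ys i = trans (cong (λ L → lineup (u ∷ v ∷ L) u u (toℕ i)) (unfold-reverse y ys))
                            (lineup-∷ʳ (posts ys) y u (toℕ i))

    module _ (ys : List (Fin n)) {p r : Fin n} (short : length ys < q) (safe : Safe (cops ys p) r) where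

      posts-bound : length (posts ys) < 2 + q
      posts-bound = subst (λ l → suc (suc l) < 2 + q) (≡-sym (length-reverse ys)) (s≤s (s≤s short))

      safe-from : ∀ {j} → j < 2 + q → ¬ Step G (lineup (posts ys) p u j) r
      safe-from j< = subst (λ c → ¬ Step G c r)
                       (cong (lineup (posts ys) p u) (toℕ-fromℕ< j<)) (safe (fromℕ< j<))

      safe-from-mobile : ¬ Step G p r
      safe-from-mobile = subst (λ c → ¬ Step G c r) (lineup-length (posts ys) p u)
                           (safe-from posts-bound)

      safe-from-guards : Undominated (guards ys) r
      safe-from-guards = All.tabulate λ x∈ → posted (∈-posts x∈)
        where
        ∈-posts : ∀ {x} → x ∈ guards ys → x ∈ posts ys
        ∈-posts x∈ with ++⁻ ys x∈
        ... | inj₁ x∈ys                = there (there (reverse⁺ x∈ys))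
        ... | inj₂ (here x≡u)          = here x≡u
        ... | inj₂ (there (here x≡v))  = there (here x≡v)

        posted : ∀ {x} → x ∈ posts ys → ¬ Step G x r
        posted x∈ with lineup-∈ (posts ys) p u x∈
        ... | j , j< , eq = subst (λ c → ¬ Step G c r) eq (safe-from (<-trans j< posts-bound))

    approach : ∀ ys → length ys < q → ∀ {p y r} → Reach G p y → AvoidingWalk (guards ys) y r
             → (∀ {r′} → AvoidingWalk (guards ys) y r′ → CopWin G (cops ys y) r′)
             → CopWin G (cops ys p) r
    approach ys short here w arrived = arrived w
    approach ys short (step {v = p′} pp′ rest) w arrived =
      move (cops ys p′) (λ i → lineup-mono (Step G) Step-refl (posts ys) u (inj₂ pp′) (toℕ i))
        (inj₂ λ r′ rr′ → CopWin-unlessSafe λ safe →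
          approach ys short rest (AvoidingWalk-snoc w rr′ (safe-from-guards ys short safe)) arrived)

    hunt : ∀ rem y ys → rem + length (y ∷ ys) ≡ q → SeparatedPath (y ∷ ys)
         → ∀ {r} → AvoidingWalk (guards ys) y r → CopWin G (cops ys y) r
    hunt rem y ys len path {r} w = CopWin-unlessSafe λ safe →
        let y≁r = safe-from-mobile ys (m+1+n≡o⇒n<o rem len) safe
        in grow rem len y≁r (last-exit y≁r w)
      where
      grow : ∀ rem → rem + length (y ∷ ys) ≡ q → ¬ Step G y r → Exit (guards ys) y r
           → CopWin G (cops ys y) r
      grow zero len y≁r (y′ , yy′ , y′-free , w′)
        with AvoidingWalk-first w′ (λ { (y≁y′ ∷ _) → y≁y′ (inj₂ yy′) }) (λ { refl → y≁r (inj₂ yy′) })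
      ... | a , y′a , a-free =
        -- the path has q vertices, and y′ followed by the next vertex a of the walk make 2 + q
        ⊥-elim (SeparatedPath-short (SeparatedPath-extend y′a a-free (SeparatedPath-extend yy′ y′-free path))
                                    (cong (2 +_) len))
      grow (suc rem) len _ (y′ , yy′ , y′-free , w′) =
        CopWin-cong (handover y ys)
          (approach (y ∷ ys) (m+1+n≡o⇒n<o rem len′) (connected u y′) w′
            (hunt rem y′ (y ∷ ys) len′ (SeparatedPath-extend yy′ y′-free path)))
        where
        len′ : rem + length (y′ ∷ y ∷ ys) ≡ q
        len′ = trans (+-suc rem (length (y ∷ ys))) len

    cops-win : ∀ rem → rem + 1 ≡ q → CopsWin G (2 + q)
    cops-win rem len = cops [] u , λ r → CopWin-unlessSafe λ safe →
      approach [] (m+1+n≡o⇒n<o rem len) (connected u r) []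
        (hunt rem r [] len (single r , safe-from-guards [] (m+1+n≡o⇒n<o rem len) safe ∷ []))

proposition2 : (k : ℕ) → 3 ≤ k → (n : ℕ) → (G : Graph n) → Connected G
    → ¬ HasInduced G (P2+PkAdj k) → CopNumber≤ G k
proposition2 (suc (suc (suc q))) (s≤s (s≤s (s≤s z≤n))) zero G connected no-P₂+Pk =
  0 , z≤n , (λ ()) , λ ()
proposition2 (suc (suc (suc q))) (s≤s (s≤s (s≤s z≤n))) (suc zero) G connected no-P₂+Pk =
  _ , ≤-refl , (λ _ → zero) , λ { zero → caught (zero , refl) }
proposition2 (suc (suc (suc q))) (s≤s (s≤s (s≤s z≤n))) (suc (suc n)) G connected no-P₂+Pk
  with connected zero (suc zero)
... | step uv _ = _ , ≤-refl , Strategy.cops-win G connected (suc q) uv no-P₂+Pk q (+-comm q 1)
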